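{- Let $G$ be a graph and let $G^{\mathsf b}$ be the graph obtained from $G$ by removing all bridges. Then $\mathsf{idf}(G)=\mathsf{idf}(G^{\mathsf b})$.
   Context: All graphs are finite, simple and undirected. A bridge is an edge whose removal increases the number of connected components. For $X\subseteq V(G)$, $G/\!\!/X$ is obtained from $G$ by deleting $X$ and adding a new vertex adjacent to every vertex of $N_G(X)=\bigcup_{v\in X}N_G(v)\setminus X$. For a partition $\mathcal{X}=\{X_1,\dots,X_p\}$ of some subset of $V(G)$ into non-empty parts, $G/\!\!/\mathcal{X}:=G/\!\!/X_1\cdots/\!\!/X_p$, with order $|X_1\cup\dots\cup X_p|$. $\mathsf{idf}(G)$ is the minimum order of such $\mathcal{X}$ with $G/\!\!/\mathcal{X}$ acyclic. -}

module Defs where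

open import Data.Nat using (ℕ; zero; suc; _+_; _<_)
open import Data.Fin using (Fin; zero; suc; inject₁; fromℕ)
open import Data.Maybe using (Maybe; just; nothing; is-just)
open import Data.Bool using (if_then_else_)
open import Data.Product using (Σ; ∃; ∃-syntax; _×_; _,_)
open import Data.Sum using (_⊎_; inj₁; inj₂)
open import Relation.Nullary using (¬_)
open import Relation.Binary.PropositionalEquality using (_≡_; _≢_)
open import Relation.Binary.Construct.Closure.ReflexiveTransitive using (Star)
open import Function.Definitions using (Injective; Surjective)
open import Function using (_∘_)
open import Level using (0ℓ)

-- A (finite simple) graph on vertex set Fin n is given by an adjacency
-- relation Adj : Fin n → Fin n → Set; symmetry, irreflexivity and
-- decidability are imposed as hypotheses in the theorem.
Rel : Set → Set₁
Rel V = V → V → Set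

Reach : ∀ {n} → Rel (Fin n) → Rel (Fin n)
Reach E = Star E

NumComp : ∀ {n} → Rel (Fin n) → ℕ → Set
NumComp {n} E k =
  Σ (Fin n → Fin k) λ c →
    Surjective _≡_ _≡_ c ×
    (∀ u v → (c u ≡ c v → Reach E u v) × (Reach E u v → c u ≡ c v))

deleteEdge : ∀ {n} → Rel (Fin n) → Fin n → Fin n → Rel (Fin n)
deleteEdge E u v a b = E a b × ¬ ((a ≡ u × b ≡ v) ⊎ (a ≡ v × b ≡ u))

IsBridge : ∀ {n} → Rel (Fin n) → Fin n → Fin n → Set
IsBridge E u v =
  E u v × ∃[ k ] ∃[ k' ] (NumComp E k × NumComp (deleteEdge E u v) k' × k < k')

removeBridges : ∀ {n} → Rel (Fin n) → Rel (Fin n)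
removeBridges E u v = E u v × ¬ IsBridge E u v

HasCycle : (V : Set) → Rel V → Set
HasCycle V R =
  ∃[ m ] Σ (Fin (3 + m) → V) λ c →
    Injective _≡_ _≡_ c ×
    (∀ (i : Fin (2 + m)) → R (c (inject₁ i)) (c (suc i))) ×
    R (c (fromℕ (2 + m))) (c zero)

Acyclic : (V : Set) → Rel V → Set
Acyclic V R = ¬ HasCycle V R

-- A partition 𝒳 = {X_1,…,X_p} of a subset of V(G) into non-empty parts is
-- encoded by a labelling f : Fin n → Maybe (Fin p): X_i = f⁻¹(just i),
-- vertices labelled nothing are outside ⋃ 𝒳.
NonEmptyParts : ∀ {n p} → (Fin n → Maybe (Fin p)) → Set
NonEmptyParts {n} {p} f = ∀ (i : Fin p) → ∃[ w ] (f w ≡ just i)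

order : ∀ {n p} → (Fin n → Maybe (Fin p)) → ℕ
order {zero} f = 0
order {suc n} f = (if is-just (f zero) then 1 else 0) + order (f ∘ suc)

-- Vertex set of G//𝒳: the unlabelled vertices of G plus one new vertex x_i per part.
CVert : (n p : ℕ) → (Fin n → Maybe (Fin p)) → Set
CVert n p f = Σ (Fin n) (λ v → f v ≡ nothing) ⊎ Fin p

-- Adjacency of G//𝒳 = G//X_1 ⋯ //X_p (unfolded):
--  old–old: as in G;  old u – x_i: u ∈ N_G(X_i);
--  x_i – x_j (i ≠ j): some vertex of X_i is adjacent in G to some vertex of X_j.
CAdj : ∀ {n p} → Rel (Fin n) → (f : Fin n → Maybe (Fin p)) → Rel (CVert n p f)
CAdj E f (inj₁ (u , _)) (inj₁ (v , _)) = E u v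
CAdj E f (inj₁ (u , _)) (inj₂ i) = ∃[ w ] (f w ≡ just i × E u w)
CAdj E f (inj₂ i) (inj₁ (u , _)) = ∃[ w ] (f w ≡ just i × E w u)
CAdj E f (inj₂ i) (inj₂ j) =
  i ≢ j × ∃[ w ] ∃[ w' ] (f w ≡ just i × f w' ≡ just j × E w w')

IdfWitness : ∀ {n} → Rel (Fin n) → (p : ℕ) → (Fin n → Maybe (Fin p)) → Set
IdfWitness {n} E p f = NonEmptyParts f × Acyclic (CVert n p f) (CAdj E f)

IsIdf : ∀ {n} → Rel (Fin n) → ℕ → Set
IsIdf {n} E k =
  (∃[ p ] ∃[ f ] (IdfWitness E p f × order f ≡ k)) ×
  (∀ p (f : Fin n → Maybe (Fin p)) → IdfWitness E p f → k Data.Nat.≤ order f)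

{-# OPTIONS --safe #-}
module Submission where

-- Deleting edges cannot create cycles in a contraction, so every witness for G is one for G^b.
-- Conversely, split each part of a witness for G^b along the components of the graph of edges
-- lying on cycles of G; this keeps the order. In the contraction of G by the refined partition,
-- an edge realised by an edge uv of G that lies on no cycle cannot lie on a cycle either: going
-- around the rest of that cycle would reconnect u and v without uv. Hence every cycle consists
-- of edges of G^b, its vertices all lie in one component, and it maps injectively onto a cycle
-- of the contraction of G^b by the original partition.

open import Defs
open import Axiom.UniquenessOfIdentityProofs using (module Decidable⇒UIP)
open import Data.Bool using (if_then_else_)
open import Data.Empty using (⊥; ⊥-elim)
open import Data.Fin as Fin using (Fin; zero; suc; inject₁; fromℕ)
import Data.Fin.Properties as Fin
open import Data.Maybe as Maybe using (Maybe; just; nothing; is-just)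
import Data.Maybe.Properties as Maybe
open import Data.Nat as ℕ using (ℕ; zero; suc; _+_; _≤_; z≤n; s≤s)
import Data.Nat.Properties as ℕ
open import Data.Product as × using (∃-syntax; _×_; _,_; proj₁; proj₂)
open import Data.Sum as ⊎ using (_⊎_; inj₁; inj₂; [_,_])
open import Function using (_∘_; _on_; id)
open import Function.Definitions using (Injective)
open import Relation.Binary.Construct.Closure.ReflexiveTransitive as Star using (Star; ε; _◅_; _◅◅_)
open import Relation.Binary.Construct.Intersection as ∩ using (_∩_)
open import Relation.Binary.Definitions using (Symmetric; Transitive; Decidable)
open import Relation.Binary.PropositionalEquality
  using (_≡_; _≢_; refl; sym; trans; cong; cong₂; subst; module ≡-Reasoning)
open import Relation.Nullary using (¬_; ¬?; Dec; yes; no)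
open import Relation.Nullary.Decidable using (map′; _×-dec_; _⊎-dec_; decidable-stable)

-- Reachability is decided by induction on n: a walk from suc a to suc b avoids zero,
-- or splits at its first entry into and its last exit from zero.
FirstEntry : ∀ {n} → Rel (Fin (suc n)) → Fin n → Set
FirstEntry E a = ∃[ x ] (Star (E on suc) a x × E (suc x) zero)

LastExit : ∀ {n} → Rel (Fin (suc n)) → Fin n → Set
LastExit E b = ∃[ y ] (E zero (suc y) × Star (E on suc) y b)

module _ {n} {E : Rel (Fin (suc n))} where

  private
    E₊ : Rel (Fin n)
    E₊ = E on suc

  star-lift : ∀ {a b} → Star E₊ a b → Star E (suc a) (suc b)
  star-lift = Star.gmap suc id

  firstEntry : ∀ {a} → Star E (suc a) zero → FirstEntry E a
  firstEntry {a} (_◅_ {j = zero} e _) = a , ε , e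
  firstEntry (_◅_ {j = suc _} e p) with firstEntry p
  ... | x , q , e′ = x , e ◅ q , e′

  lastExit : ∀ {b} → Star E zero (suc b) → LastExit E b
  avoidsZero⊎visits : ∀ {a b} → Star E (suc a) (suc b) → Star E₊ a b ⊎ (FirstEntry E a × LastExit E b)

  lastExit (_◅_ {j = zero} _ p) = lastExit p
  lastExit (_◅_ {j = suc j} e p) with avoidsZero⊎visits p
  ... | inj₁ q = j , e , q
  ... | inj₂ (_ , exit) = exit

  avoidsZero⊎visits ε = inj₁ ε
  avoidsZero⊎visits {a} (_◅_ {j = zero} e p) = inj₂ ((a , ε , e) , lastExit p)
  avoidsZero⊎visits (_◅_ {j = suc _} e p) with avoidsZero⊎visits p
  ... | inj₁ q = inj₁ (e ◅ q)
  ... | inj₂ ((x , q , e′) , exit) = inj₂ ((x , e ◅ q , e′) , exit)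

star? : ∀ {n} {E : Rel (Fin n)} → Decidable E → Decidable (Star E)
star? {suc n} {E} E? = go
  where
  E₊? : Decidable (E on suc)
  E₊? a b = E? (suc a) (suc b)

  firstEntry? : ∀ a → Dec (FirstEntry E a)
  firstEntry? a = Fin.any? λ x → star? E₊? a x ×-dec E? (suc x) zero

  lastExit? : ∀ b → Dec (LastExit E b)
  lastExit? b = Fin.any? λ y → E? zero (suc y) ×-dec star? E₊? y b

  enter : ∀ {a} → FirstEntry E a → Star E (suc a) zero
  enter (_ , p , e) = star-lift p ◅◅ e ◅ ε

  exit : ∀ {b} → LastExit E b → Star E zero (suc b)
  exit (_ , e , p) = e ◅ star-lift p

  go : Decidable (Star E)
  go zero zero = yes ε
  go (suc a) zero = map′ enter firstEntry (firstEntry? a)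
  go zero (suc b) = map′ exit lastExit (lastExit? b)
  go (suc a) (suc b) =
    map′ [ star-lift , (λ (i , o) → enter i ◅◅ exit o) ] avoidsZero⊎visits
         (star? E₊? a b ⊎-dec (firstEntry? a ×-dec lastExit? b))

numComp-≤ : ∀ {n} {R T : Rel (Fin n)} {k k′} → (∀ {a b} → Reach T a b → Reach R a b) →
            NumComp T k → NumComp R k′ → k′ ≤ k
numComp-≤ {n} {k′ = k′} T⊆R (c , _ , c-comp) (c′ , c′-surj , c′-comp) =
  Fin.injective⇒≤ pick-injective
  where
  pick : Fin k′ → Fin n
  pick i = proj₁ (c′-surj i)

  pick-injective : Injective _≡_ _≡_ (c ∘ pick)
  pick-injective {i} {j} eq = begin
    i              ≡⟨ sym (proj₂ (c′-surj i) refl) ⟩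
    c′ (pick i)    ≡⟨ proj₂ (c′-comp _ _) (T⊆R (proj₁ (c-comp _ _) eq)) ⟩
    c′ (pick j)    ≡⟨ proj₂ (c′-surj j) refl ⟩
    j              ∎
    where open ≡-Reasoning

endpoints? : ∀ {n} (u v a b : Fin n) → Dec ((a ≡ u × b ≡ v) ⊎ (a ≡ v × b ≡ u))
endpoints? u v a b = (a Fin.≟ u ×-dec b Fin.≟ v) ⊎-dec (a Fin.≟ v ×-dec b Fin.≟ u)

-- A decidable substitute for non-bridges; the argument only needs cyclic⇒removeBridges.
CyclicEdge : ∀ {n} → Rel (Fin n) → Rel (Fin n)
CyclicEdge E u v = E u v × Star (deleteEdge E u v) u v

CyclicEdge? : ∀ {n} {E : Rel (Fin n)} → Decidable E → Decidable (CyclicEdge E)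
CyclicEdge? {E = E} E? u v = E? u v ×-dec star? deleteEdge? u v
  where
  deleteEdge? : Decidable (deleteEdge E u v)
  deleteEdge? a b = E? a b ×-dec ¬? (endpoints? u v a b)

module _ {n} {E : Rel (Fin n)} (E-sym : Symmetric E) where

  deleteEdge-sym : ∀ {u v} → Symmetric (deleteEdge E u v)
  deleteEdge-sym (e , ¬uv) = E-sym e , ¬uv ∘ ⊎.swap ∘ ⊎.map ×.swap ×.swap

  deleteEdge-comm : ∀ {u v a b} → deleteEdge E u v a b → deleteEdge E v u a b
  deleteEdge-comm (e , ¬uv) = e , ¬uv ∘ ⊎.swap

  reconnect : ∀ {u v} → Star (deleteEdge E u v) u v → ∀ {a b} → Star E a b → Star (deleteEdge E u v) a b
  reconnect {u} {v} uv p = p Star.>>= edge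
    where
    edge : ∀ {a b} → E a b → Star (deleteEdge E u v) a b
    edge {a} {b} e with endpoints? u v a b
    ... | yes (inj₁ (refl , refl)) = uv
    ... | yes (inj₂ (refl , refl)) = Star.reverse deleteEdge-sym uv
    ... | no ¬uv = (e , ¬uv) ◅ ε

  CyclicEdge-sym : Symmetric (CyclicEdge E)
  CyclicEdge-sym (e , p) = E-sym e , Star.map deleteEdge-comm (Star.reverse deleteEdge-sym p)

  cyclic⇒removeBridges : ∀ {u v} → CyclicEdge E u v → removeBridges E u v
  cyclic⇒removeBridges (e , p) = e , λ (_ , k , k′ , comp , comp′ , k<k′) →
    ℕ.<⇒≱ k<k′ (numComp-≤ (reconnect p) comp comp′)

record Quotient {n} (P : Rel (Fin n)) : Set where
  field
    {size}   : ℕ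
    label    : Fin n → Maybe (Fin size)
    nonEmpty : NonEmptyParts label
    sound    : ∀ {w w′ j} → label w ≡ just j → label w′ ≡ just j → P w w′
    complete : ∀ {w w′} → P w w′ → ∃[ j ] (label w ≡ just j × label w′ ≡ just j)

module ExtendQuotient {n} {P : Rel (Fin (suc n))} (P-sym : Symmetric P) (P-trans : Transitive P)
                      (Q : Quotient (P on suc)) where
  open Quotient Q

  unlabelled : ¬ P zero zero → Quotient P
  unlabelled ¬P00 = record
    { label    = λ { zero → nothing ; (suc w) → label w }
    ; nonEmpty = λ j → let (w , lw) = nonEmpty j in suc w , lw
    ; sound    = λ { {suc _} {suc _} → sound }
    ; complete = λ { {zero} p → ⊥-elim (¬P00 (P-trans p (P-sym p)))
                   ; {suc _} {zero} p → ⊥-elim (¬P00 (P-trans (P-sym p) p))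
                   ; {suc _} {suc _} → complete }
    }

  joining : ∀ {w₀} → P zero (suc w₀) → Quotient P
  joining {w₀} P0w₀ = record
    { label    = λ { zero → label w₀ ; (suc w) → label w }
    ; nonEmpty = λ j → let (w , lw) = nonEmpty j in suc w , lw
    ; sound    = λ { {zero} {zero} _ _ → P-trans P0w₀ (P-sym P0w₀)
                   ; {zero} {suc _} l l′ → P-trans P0w₀ (sound l l′)
                   ; {suc _} {zero} l l′ → P-trans (sound l l′) (P-sym P0w₀)
                   ; {suc _} {suc _} → sound }
    ; complete = λ { {zero} {zero} _ → complete (P-trans (P-sym P0w₀) P0w₀)
                   ; {zero} {suc _} p → complete (P-trans (P-sym P0w₀) p)
                   ; {suc _} {zero} p → complete (P-trans p P0w₀)
                   ; {suc _} {suc _} → complete }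
    }

  fresh : P zero zero → ¬ (∃[ w ] P zero (suc w)) → Quotient P
  fresh P00 isolated = record
    { size     = suc size
    ; label    = label′
    ; nonEmpty = λ { zero → zero , refl
                   ; (suc j) → let (w , lw) = nonEmpty j in suc w , cong (Maybe.map Fin.suc) lw }
    ; sound    = λ { {zero} {zero} _ _ → P00
                   ; {zero} {suc w′} refl l′ → ⊥-elim (shifted≢zero (label w′) l′)
                   ; {suc w} {zero} l refl → ⊥-elim (shifted≢zero (label w) l)
                   ; {suc w} {suc _} {zero} l _ → ⊥-elim (shifted≢zero (label w) l)
                   ; {suc _} {suc _} {suc _} l l′ → sound (unshift l) (unshift l′) }
    ; complete = λ { {zero} {zero} _ → zero , refl , refl
                   ; {zero} {suc w} p → ⊥-elim (isolated (w , p))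
                   ; {suc w} {zero} p → ⊥-elim (isolated (w , P-sym p))
                   ; {suc _} {suc _} p → let (j , l , l′) = complete p in
                                          suc j , cong (Maybe.map Fin.suc) l , cong (Maybe.map Fin.suc) l′ }
    }
    where
    label′ : Fin (suc n) → Maybe (Fin (suc size))
    label′ zero    = just zero
    label′ (suc w) = Maybe.map Fin.suc (label w)

    shifted≢zero : ∀ (x : Maybe (Fin size)) → Maybe.map Fin.suc x ≢ just zero
    shifted≢zero (just _)  ()
    shifted≢zero nothing   ()

    unshift : ∀ {x : Maybe (Fin size)} {i} → Maybe.map Fin.suc x ≡ just (suc i) → x ≡ just i
    unshift = Maybe.map-injective Fin.suc-injective

quotient : ∀ {n} {P : Rel (Fin n)} → Symmetric P → Transitive P → Decidable P → Quotient P
quotient {zero} _ _ _ = record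
  { size = 0 ; label = λ () ; nonEmpty = λ () ; sound = λ { {()} } ; complete = λ { {()} } }
quotient {suc n} {P} P-sym P-trans P? = extend (P? zero zero) (Fin.any? λ w → P? zero (suc w))
  where
  open ExtendQuotient {P = P} P-sym P-trans (quotient P-sym P-trans λ a b → P? (suc a) (suc b))

  extend : Dec (P zero zero) → Dec (∃[ w ] P zero (suc w)) → Quotient P
  extend (no ¬P00) _              = unlabelled ¬P00
  extend (yes _)   (yes (_ , P0w₀)) = joining P0w₀
  extend (yes P00) (no isolated)  = fresh P00 isolated

data Step (m : ℕ) : Set where
  forward : Fin (2 + m) → Step m
  back    : Step m

src tgt : ∀ {m} → Step m → Fin (3 + m)
src (forward i) = inject₁ i
src {m} back    = fromℕ (2 + m)
tgt (forward i) = suc i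
tgt back        = zero

src-injective : ∀ {m} → Injective _≡_ _≡_ (src {m})
src-injective {x = forward i} {forward j} eq = cong forward (Fin.inject₁-injective eq)
src-injective {x = forward i} {back}      eq = ⊥-elim (Fin.fromℕ≢inject₁ (sym eq))
src-injective {x = back}      {forward j} eq = ⊥-elim (Fin.fromℕ≢inject₁ eq)
src-injective {x = back}      {back}      _  = refl

-- This is where cycles have length at least 3: the two steps of a 2-cycle are reverses of each other.
no-reversed-steps : ∀ {m} (s t : Step m) → src s ≡ tgt t → tgt s ≡ src t → ⊥
no-reversed-steps (forward i)       (forward j)       = reversed
  where
  reversed : ∀ {N} {i j : Fin N} → inject₁ i ≡ suc j → suc i ≡ inject₁ j → ⊥
  reversed {i = suc _} {suc _} p q = reversed (Fin.suc-injective p) (Fin.suc-injective q)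
no-reversed-steps (forward zero)    back    _ ()
no-reversed-steps (forward (suc _)) back    () _
no-reversed-steps back    (forward zero)    () _
no-reversed-steps back    (forward (suc _)) _ ()
no-reversed-steps back    back    ()

record Cycle (V : Set) (R : Rel V) : Set where
  field
    {m}       : ℕ
    vertex    : Fin (3 + m) → V
    injective : Injective _≡_ _≡_ vertex
    adjacent  : ∀ s → R (vertex (src s)) (vertex (tgt s))

toCycle : ∀ {V R} → HasCycle V R → Cycle V R
toCycle (_ , c , c-injective , along , close) = record
  { vertex = c ; injective = c-injective ; adjacent = λ { (forward i) → along i ; back → close } }

fromCycle : ∀ {V R} → Cycle V R → HasCycle V R
fromCycle C = _ , vertex , injective , adjacent ∘ forward , adjacent back
  where open Cycle C

walk : ∀ {A : Set} {T : Rel A} {N} (g : Fin (suc N) → A) {a b : Fin (suc N)} → a Fin.≤ b →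
       (∀ j → a Fin.≤ inject₁ j → inject₁ j Fin.< b → Star T (g (inject₁ j)) (g (suc j))) →
       Star T (g a) (g b)
walk g {zero} {zero} _ _ = ε
walk {N = suc _} g {zero} {suc b} _ h =
  h zero z≤n (s≤s z≤n) ◅◅ walk (g ∘ suc) z≤n (λ j _ j<b → h (suc j) z≤n (s≤s j<b))
walk {N = suc _} g {suc a} {suc b} (s≤s a≤b) h =
  walk (g ∘ suc) a≤b (λ j a≤j j<b → h (suc j) (s≤s a≤j) (s≤s j<b))

detour : ∀ {A : Set} {T : Rel A} {m} (g : Fin (3 + m) → A) (s : Step m) →
         (∀ t → t ≢ s → Star T (g (src t)) (g (tgt t))) → Star T (g (tgt s)) (g (src s))
detour {T = T} {m} g (forward i) h = toEnd ◅◅ h back (λ ()) ◅◅ fromStart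
  where
  fromStart : Star T (g zero) (g (inject₁ i))
  fromStart = walk g z≤n λ j _ j<i → h (forward j) λ { refl → Fin.<-irrefl refl j<i }

  toEnd : Star T (g (suc i)) (g (fromℕ (2 + m)))
  toEnd = walk g (Fin.≤fromℕ (suc i)) λ j i<j _ →
    h (forward j) λ { refl → ℕ.<-irrefl (sym (Fin.toℕ-inject₁ i)) i<j }
detour g back h = walk g z≤n λ j _ _ → h (forward j) λ ()

HasCycle-mono : ∀ {V} {R T : Rel V} → (∀ x y → R x y → T x y) → HasCycle V R → HasCycle V T
HasCycle-mono R⊆T (m , c , c-injective , along , close) =
  m , c , c-injective , (λ i → R⊆T _ _ (along i)) , R⊆T _ _ close

Member : ∀ {n p} (f : Fin n → Maybe (Fin p)) → Fin n → CVert n p f → Set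
Member f w (inj₁ (v , _)) = w ≡ v
Member f w (inj₂ i)       = f w ≡ just i

module _ {n p} {f : Fin n → Maybe (Fin p)} where

  member-unique : ∀ {w} x y → Member f w x → Member f w y → x ≡ y
  member-unique (inj₁ (v , v∉)) (inj₁ (v , v∉′)) refl refl =
    cong (λ v∉ → inj₁ (v , v∉)) (Decidable⇒UIP.≡-irrelevant (Maybe.≡-dec Fin._≟_) v∉ v∉′)
  member-unique (inj₁ (v , v∉)) (inj₂ j) refl fv with () ← trans (sym v∉) fv
  member-unique (inj₂ i) (inj₁ (v , v∉)) fv refl with () ← trans (sym v∉) fv
  member-unique (inj₂ i) (inj₂ j) fi fj = cong inj₂ (Maybe.just-injective (trans (sym fi) fj))

  representative : NonEmptyParts f → ∀ x → ∃[ w ] Member f w x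
  representative _        (inj₁ (v , _)) = v , refl
  representative nonEmpty (inj₂ i)       = nonEmpty i

  record EdgeBetween (E : Rel (Fin n)) (x y : CVert n p f) : Set where
    constructor edgeBetween
    field
      {from to} : Fin n
      from∈x    : Member f from x
      to∈y      : Member f to y
      edge      : E from to

  CAdj⇒EdgeBetween : ∀ {E} x y → CAdj E f x y → EdgeBetween E x y
  CAdj⇒EdgeBetween (inj₁ _) (inj₁ _) e                         = edgeBetween refl refl e
  CAdj⇒EdgeBetween (inj₁ _) (inj₂ _) (_ , fw , e)              = edgeBetween refl fw e
  CAdj⇒EdgeBetween (inj₂ _) (inj₁ _) (_ , fw , e)              = edgeBetween fw refl e
  CAdj⇒EdgeBetween (inj₂ _) (inj₂ _) (_ , _ , _ , fw , fw′ , e) = edgeBetween fw fw′ e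

  EdgeBetween⇒CAdj : ∀ {E} x y → x ≢ y → EdgeBetween E x y → CAdj E f x y
  EdgeBetween⇒CAdj (inj₁ _) (inj₁ _) _   (edgeBetween refl refl e) = e
  EdgeBetween⇒CAdj (inj₁ _) (inj₂ _) _   (edgeBetween refl fw′ e)  = _ , fw′ , e
  EdgeBetween⇒CAdj (inj₂ _) (inj₁ _) _   (edgeBetween fw refl e)   = _ , fw , e
  EdgeBetween⇒CAdj (inj₂ _) (inj₂ _) x≢y (edgeBetween fw fw′ e)    = x≢y ∘ cong inj₂ , _ , _ , fw , fw′ , e

  CAdj-mono : ∀ {R T : Rel (Fin n)} → (∀ {a b} → R a b → T a b) → ∀ x y → CAdj R f x y → CAdj T f x y
  CAdj-mono R⊆T (inj₁ _) (inj₁ _) e                             = R⊆T e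
  CAdj-mono R⊆T (inj₁ _) (inj₂ _) (w , fw , e)                  = w , fw , R⊆T e
  CAdj-mono R⊆T (inj₂ _) (inj₁ _) (w , fw , e)                  = w , fw , R⊆T e
  CAdj-mono R⊆T (inj₂ _) (inj₂ _) (i≢j , w , w′ , fw , fw′ , e) = i≢j , w , w′ , fw , fw′ , R⊆T e

IdfWitness-antimono : ∀ {n p} {R T : Rel (Fin n)} {f : Fin n → Maybe (Fin p)} →
                      (∀ {a b} → R a b → T a b) → IdfWitness T p f → IdfWitness R p f
IdfWitness-antimono R⊆T (nonEmpty , acyclic) = nonEmpty , acyclic ∘ HasCycle-mono (CAdj-mono R⊆T)

order-coarsen : ∀ {n p q} (h : Fin p → Fin q) (f : Fin n → Maybe (Fin p)) (g : Fin n → Maybe (Fin q)) →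
                (∀ w → Maybe.map h (f w) ≡ g w) → order f ≡ order g
order-coarsen {zero}  h f g refines = refl
order-coarsen {suc n} h f g refines =
  cong₂ _+_ (cong (λ b → if b then 1 else 0) (labelled-cong (refines zero)))
            (order-coarsen h (f ∘ suc) (g ∘ suc) (refines ∘ suc))
  where
  labelled-cong : ∀ {x y} → Maybe.map h x ≡ y → is-just x ≡ is-just y
  labelled-cong {just _}  refl = refl
  labelled-cong {nothing} refl = refl

module Coarsening {n p q} {f : Fin n → Maybe (Fin p)} {g : Fin n → Maybe (Fin q)}
                  (h : Fin p → Fin q) (refines : ∀ w → Maybe.map h (f w) ≡ g w) where

  coarsen : CVert n p f → CVert n q g
  coarsen (inj₁ (v , v∉)) = inj₁ (v , trans (sym (refines v)) (cong (Maybe.map h) v∉))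
  coarsen (inj₂ i)        = inj₂ (h i)

  member-coarsen : ∀ {w} x → Member f w x → Member g w (coarsen x)
  member-coarsen (inj₁ _) refl = refl
  member-coarsen (inj₂ _) fw   = trans (sym (refines _)) (cong (Maybe.map h) fw)

module Refinement {n} {E H : Rel (Fin n)} (E-sym : Symmetric E) (E? : Decidable E)
                  (cyclic⊆H : ∀ {a b} → CyclicEdge E a b → H a b)
                  {p} {f : Fin n → Maybe (Fin p)} (f-witness : IdfWitness H p f) where

  Joined : Rel (Fin n)
  Joined = Star (CyclicEdge E)

  Joined-sym : Symmetric Joined
  Joined-sym = Star.reverse (CyclicEdge-sym E-sym)

  SharedLabel : Rel (Fin n)
  SharedLabel w w′ = ∃[ i ] (f w ≡ just i × f w′ ≡ just i)

  -- Without this split, bridges between different parts of f could close cycles in the contraction of G.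
  SameBlock : Rel (Fin n)
  SameBlock = SharedLabel ∩ Joined

  sameBlock : Quotient SameBlock
  sameBlock = quotient (∩.symmetric SharedLabel Joined shared-sym Joined-sym)
                       (∩.transitive SharedLabel Joined shared-trans _◅◅_)
                       (∩.decidable shared? (star? (CyclicEdge? E?)))
    where
    shared-sym : Symmetric SharedLabel
    shared-sym (i , fw , fw′) = i , fw′ , fw

    shared-trans : Transitive SharedLabel
    shared-trans (i , fu , fv) (j , fv′ , fw) =
      i , fu , trans fw (cong just (Maybe.just-injective (trans (sym fv′) fv)))

    shared? : Decidable SharedLabel
    shared? w w′ = Fin.any? λ i → f w ≟ just i ×-dec f w′ ≟ just i
      where
      _≟_ : (x y : Maybe (Fin p)) → Dec (x ≡ y)
      _≟_ = Maybe.≡-dec Fin._≟_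

  open Quotient sameBlock using (size; nonEmpty; sound; complete) renaming (label to f′)

  coarse : Fin size → Fin p
  coarse j = let (_ , rep∈) = nonEmpty j in proj₁ (proj₁ (sound rep∈ rep∈))

  label-coarse : ∀ {w j} → f′ w ≡ just j → f w ≡ just (coarse j)
  label-coarse {j = j} f′w =
    let (_ , rep∈) = nonEmpty j
        ((_ , fw , frep) , _) = sound f′w rep∈
        ((_ , frep′ , _) , _) = sound rep∈ rep∈
    in trans fw (trans (sym frep) frep′)

  refines : ∀ w → Maybe.map coarse (f′ w) ≡ f w
  refines w with f′ w in f′w | f w in fw
  ... | just j  | _       = trans (sym (label-coarse f′w)) fw
  ... | nothing | nothing = refl
  ... | nothing | just i  with () ← trans (sym f′w) (proj₁ (proj₂ (complete ((i , fw , fw) , ε))))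

  open Coarsening {f = f′} coarse refines

  members-joined : ∀ {w w′} x → Member f′ w x → Member f′ w′ x → Joined w w′
  members-joined (inj₁ _) refl refl = ε
  members-joined (inj₂ _) l    l′   = proj₂ (sound l l′)

  joined-comember : ∀ {w w′} X x → Member f w X → Member f w′ X → Joined w w′ →
                    Member f′ w x → Member f′ w′ x
  joined-comember (inj₁ _) _              refl refl _ w∈x  = w∈x
  joined-comember (inj₂ i) (inj₁ (v , v∉)) fw fw′ J refl
    with () ← trans (sym v∉) (proj₁ (proj₂ (complete ((i , fw , fw′) , J))))
  joined-comember (inj₂ i) (inj₂ _)        fw fw′ J f′w =
    let (_ , l , l′) = complete ((i , fw , fw′) , J) in trans l′ (trans (sym l) f′w)

  coarsen-injective : ∀ {w w′} x y → Member f′ w x → Member f′ w′ y → Joined w w′ →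
                      coarsen x ≡ coarsen y → x ≡ y
  coarsen-injective {w′ = w′} x y w∈x w′∈y J eq = member-unique x y w′∈x w′∈y
    where
    w′∈x : Member f′ w′ x
    w′∈x = joined-comember (coarsen x) x (member-coarsen x w∈x)
                         (subst (Member f w′) (sym eq) (member-coarsen y w′∈y)) J w∈x

  module _ (C : Cycle (CVert n size f′) (CAdj E f′)) where
    open Cycle C

    rep : Fin (3 + m) → Fin n
    rep a = proj₁ (representative nonEmpty (vertex a))

    rep∈ : ∀ a → Member f′ (rep a) (vertex a)
    rep∈ a = proj₂ (representative nonEmpty (vertex a))

    position-unique : ∀ {w w′ a b} → w ≡ w′ → Member f′ w (vertex a) → Member f′ w′ (vertex b) → a ≡ b
    position-unique refl w∈a w∈b = injective (member-unique _ _ w∈a w∈b)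

    crossing : ∀ s → EdgeBetween E (vertex (src s)) (vertex (tgt s))
    crossing s = CAdj⇒EdgeBetween _ _ (adjacent s)

    step-joined : ∀ {T : Rel (Fin n)} → (∀ {a b} → CyclicEdge E a b → T a b) → ∀ s →
                  T (EdgeBetween.from (crossing s)) (EdgeBetween.to (crossing s)) →
                  Star T (rep (src s)) (rep (tgt s))
    step-joined cyclic⊆T s e =
      Star.map cyclic⊆T (members-joined _ (rep∈ _) from∈x) ◅◅ e ◅
      Star.map cyclic⊆T (members-joined _ to∈y (rep∈ _))
      where open EdgeBetween (crossing s)

    -- Otherwise going around the rest of the cycle reconnects the ends of the crossing edge without it.
    crossing-cyclic : ∀ s → CyclicEdge E (EdgeBetween.from (crossing s)) (EdgeBetween.to (crossing s))
    crossing-cyclic s = decidable-stable (CyclicEdge? E? from to) λ ¬cyclic → ¬cyclic (edge , bypass ¬cyclic)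
      where
      open EdgeBetween (crossing s)

      bypass : ¬ CyclicEdge E from to → Star (deleteEdge E from to) from to
      bypass ¬cyclic = Star.reverse (deleteEdge-sym E-sym)
        (Star.map avoid (members-joined _ to∈y (rep∈ _)) ◅◅ detour rep s others ◅◅
         Star.map avoid (members-joined _ (rep∈ _) from∈x))
        where
        avoid : ∀ {a b} → CyclicEdge E a b → deleteEdge E from to a b
        avoid (e , p) = e , λ { (inj₁ (refl , refl)) → ¬cyclic (e , p)
                              ; (inj₂ (refl , refl)) → ¬cyclic (CyclicEdge-sym E-sym (e , p)) }

        others : ∀ t → t ≢ s → Star (deleteEdge E from to) (rep (src t)) (rep (tgt t))
        others t t≢s = step-joined avoid t (EdgeBetween.edge (crossing t) , not-this-edge)
          where
          open EdgeBetween (crossing t) renaming (from to from′; to to to′; from∈x to from′∈; to∈y to to′∈)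
          not-this-edge : ¬ ((from′ ≡ from × to′ ≡ to) ⊎ (from′ ≡ to × to′ ≡ from))
          not-this-edge (inj₁ (same , _)) = t≢s (src-injective (position-unique same from′∈ from∈x))
          not-this-edge (inj₂ (crossed , crossed′)) =
            no-reversed-steps t s (position-unique crossed from′∈ to∈y) (position-unique crossed′ to′∈ from∈x)

    joined-to-start : ∀ a → Joined (rep zero) (rep a)
    joined-to-start a = walk rep z≤n λ j _ _ → step-joined id (forward j) (crossing-cyclic (forward j))

    image : Cycle (CVert n p f) (CAdj H f)
    image = record { vertex = coarsen ∘ vertex ; injective = image-injective ; adjacent = image-adjacent }
      where
      image-injective : Injective _≡_ _≡_ (coarsen ∘ vertex)
      image-injective {a} {b} = injective ∘ coarsen-injective (vertex a) (vertex b) (rep∈ a) (rep∈ b)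
        (Joined-sym (joined-to-start a) ◅◅ joined-to-start b)

      image-adjacent : ∀ s → CAdj H f (coarsen (vertex (src s))) (coarsen (vertex (tgt s)))
      image-adjacent s =
        EdgeBetween⇒CAdj _ _ (λ eq → no-reversed-steps s s (image-injective eq) (sym (image-injective eq)))
        (edgeBetween (member-coarsen _ from∈x) (member-coarsen _ to∈y) (cyclic⊆H (crossing-cyclic s)))
        where open EdgeBetween (crossing s)

  refined-witness : IdfWitness E size f′
  refined-witness = nonEmpty , proj₂ f-witness ∘ fromCycle ∘ image ∘ toCycle

  refined-order : order f′ ≡ order f
  refined-order = order-coarsen coarse f′ f refines

IdfAttains : ∀ {n} → Rel (Fin n) → ℕ → Set
IdfAttains {n} E k = ∃[ p ] ∃[ f ] (IdfWitness {n} E p f × order f ≡ k)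

IsIdf-transfer : ∀ {n} {E F : Rel (Fin n)} → (∀ {k} → IdfAttains E k → IdfAttains F k) →
                 (∀ {k} → IdfAttains F k → IdfAttains E k) → ∀ {k} → IsIdf E k → IsIdf F k
IsIdf-transfer E⇒F F⇒E {k} (attained , minimal) = E⇒F attained , λ p f wit →
  let (p′ , f′ , wit′ , same) = F⇒E (p , f , wit , refl) in subst (k ≤_) same (minimal p′ f′ wit′)

IdfAttains-antimono : ∀ {n} {R T : Rel (Fin n)} → (∀ {a b} → R a b → T a b) →
                      ∀ {k} → IdfAttains T k → IdfAttains R k
IdfAttains-antimono R⊆T (p , f , witness , order≡k) = p , f , IdfWitness-antimono R⊆T witness , order≡k

IdfAttains-fromCyclicEdges : ∀ {n} {E H : Rel (Fin n)} → Symmetric E → Decidable E →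
                             (∀ {a b} → CyclicEdge E a b → H a b) → ∀ {k} → IdfAttains H k → IdfAttains E k
IdfAttains-fromCyclicEdges E-sym E? cyclic⊆H (_ , _ , witness , refl) =
  _ , _ , refined-witness , refined-order
  where open Refinement E-sym E? cyclic⊆H witness

lemma3p3 : (n : ℕ) (E : Fin n → Fin n → Set) →
    Symmetric E → (∀ v → ¬ E v v) → Decidable E →
    (k : ℕ) → (IsIdf E k → IsIdf (removeBridges E) k) × (IsIdf (removeBridges E) k → IsIdf E k)
lemma3p3 n E E-sym _ E? k =
  IsIdf-transfer withoutBridges withBridges , IsIdf-transfer withBridges withoutBridges
  where
  withoutBridges : ∀ {k} → IdfAttains E k → IdfAttains (removeBridges E) k
  withoutBridges = IdfAttains-antimono proj₁

  withBridges : ∀ {k} → IdfAttains (removeBridges E) k → IdfAttains E k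
  withBridges = IdfAttains-fromCyclicEdges E-sym E? (cyclic⇒removeBridges E-sym)
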